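{- For all integers $k\geq 1$ and $n\geq 2$ there is a $k$-connected (finite, simple) graph $G_{n,k}$ such that $\beta(G_{n,k})\leq 2k$ and $\beta(G_{n,k}\,\square\,G_{n,k})\geq n$.
   Context: $d(v,w)$ denotes shortest-path distance. A vertex $x$ resolves $v,w$ if $d(v,x)\neq d(w,x)$; a set $S$ resolves a graph if every pair of distinct vertices is resolved by some vertex of $S$; $\beta(G)$ (the metric dimension) is the minimum size of a resolving set of $G$. The cartesian product $G\,\square\,H$ has vertex set $V(G)\times V(H)$, with $(a,v)\sim(b,w)$ iff ($a=b$ and $vw\in E(H)$) or ($v=w$ and $ab\in E(G)$). -}

module Defs where

open import Data.Nat using (ℕ; zero; suc; _+_; _*_; _≤_; _<_)
open import Data.Fin using (Fin; remQuot)
open import Data.Fin.Subset using (Subset; _∈_; _∉_; ∣_∣)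
open import Data.Product using (Σ; ∃; ∃-syntax; _×_; _,_; proj₁; proj₂)
open import Data.Sum using (_⊎_)
open import Relation.Nullary using (¬_)
open import Relation.Binary.PropositionalEquality using (_≡_; _≢_)
open import Relation.Binary.Definitions using (Decidable)

record SimpleGraph (N : ℕ) : Set₁ where
  field
    Adj    : Fin N → Fin N → Set
    sym    : ∀ {u v} → Adj u v → Adj v u
    irrefl : ∀ {u} → ¬ Adj u u
    adj?   : Decidable Adj
open SimpleGraph public

Rel : ℕ → Set₁
Rel N = Fin N → Fin N → Set

data Walk {N : ℕ} (E : Rel N) : Fin N → Fin N → ℕ → Set where
  nil  : ∀ {v} → Walk E v v zero
  cons : ∀ {u v w m} → E u v → Walk E v w m → Walk E u w (suc m)

Dist : ∀ {N} → Rel N → Fin N → Fin N → ℕ → Set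
Dist E v w m = Walk E v w m × (∀ m′ → Walk E v w m′ → m ≤ m′)

_□_ : ∀ {M N} → Rel M → Rel N → Rel (M * N)
_□_ {M} {N} EG EH i j =
  (a ≡ b × EH v w) ⊎ (v ≡ w × EG a b)
  where
  a = proj₁ (remQuot {M} N i)
  v = proj₂ (remQuot {M} N i)
  b = proj₁ (remQuot {M} N j)
  w = proj₂ (remQuot {M} N j)

Resolves : ∀ {N} → Rel N → Fin N → Fin N → Fin N → Set
Resolves E x v w = ∀ a b → Dist E v x a → Dist E w x b → a ≢ b

Resolving : ∀ {N} → Rel N → Subset N → Set
Resolving {N} E S = ∀ (v w : Fin N) → v ≢ w → ∃[ x ] (x ∈ S × Resolves E x v w)

MetricDim≤ : ∀ {N} → Rel N → ℕ → Set
MetricDim≤ {N} E b = ∃[ S ] (Resolving E S × ∣ S ∣ ≤ b)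

MetricDim≥ : ∀ {N} → Rel N → ℕ → Set
MetricDim≥ {N} E b = ∀ (S : Subset N) → Resolving E S → b ≤ ∣ S ∣

Delete : ∀ {N} → Subset N → Rel N → Rel N
Delete X E u v = u ∉ X × v ∉ X × E u v

KConnected : ∀ {N} → ℕ → SimpleGraph N → Set
KConnected {N} k G =
  k < N × (∀ (X : Subset N) → ∣ X ∣ < k →
             ∀ (v w : Fin N) → v ∉ X → w ∉ X → ∃[ m ] Walk (Delete X (Adj G)) v w m)

-- G is the cartesian product of the comb C (a path p₀ … p_{n-1} with a pendant tooth t_i
-- attached to every p_i) and the complete graph K_k. Fewer than k vertices miss some copy
-- of C entirely, and every vertex lies in or next to that copy, so G is k-connected. The
-- ends of the path resolve C: p_i and t_i are at distances i and i + 1 from one end and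
-- n - 1 - i and n - i from the other, and these pairs are all different. The copies of
-- the two ends in the k layers then resolve G. A vertex y of G not of the form (t_i, c)
-- satisfies d((t_i,0), y) = 1 + d((p_i,0), y), so in G □ G the vertices
-- ((t_i,0),(p_j,0)) and ((p_i,0),(t_j,0)) are resolved only by a landmark whose first
-- coordinate lies over t_i or whose second coordinate lies over t_j. Hence a resolving
-- set of G □ G lies over all n teeth in one of the two coordinates.
module Submission where

open import Defs
open import Data.Nat using (ℕ; zero; suc; _+_; _*_; _≤_; _<_; z≤n; s≤s; z<s; >-nonZero)
open import Data.Nat.Induction using (<-rec)
import Data.Nat.Properties as ℕ
open import Data.Nat.Tactic.RingSolver using (solve-∀)
open import Data.Fin using (Fin; toℕ; combine; remQuot; opposite; inject₁)
import Data.Fin.Properties as Fin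
open import Data.Fin.Subset using (Subset; ∣_∣; _∈_; _∉_; ⊥; ⁅_⁆; _∪_; inside; outside)
import Data.Fin.Subset.Properties as Subset
open import Data.Product using (Σ; _×_; ∃-syntax; _,_; proj₁; proj₂; uncurry)
open import Data.Sum using (_⊎_; inj₁; inj₂)
open import Data.Vec using ([]; _∷_; here; there)
open import Data.Empty using (⊥-elim)
open import Function using (_∘_; flip; Injective)
open import Relation.Nullary using (¬_; Dec; yes; no; map′; ¬?; _×-dec_; _⊎-dec_)
open import Relation.Binary.Definitions using (Decidable; Symmetric; tri<; tri≈; tri>)
import Relation.Binary.PropositionalEquality as ≡
open ≡ using (_≡_; _≢_; refl; cong; cong₂; subst; subst₂)

Least : (ℕ → Set) → ℕ → Set
Least P m = P m × (∀ k → P k → m ≤ k)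

least-witness : ∀ {P : ℕ → Set} → (∀ n → Dec (P n)) → ∀ {n} → P n → ∃[ m ] Least P m
least-witness {P} P? {n} = <-rec (λ n → P n → ∃[ m ] Least P m) search n
  where
  search : ∀ n → (∀ {k} → k < n → P k → ∃[ m ] Least P m) → P n → ∃[ m ] Least P m
  search n smaller Pn with ℕ.anyUpTo? P? n
  ... | yes (k , k<n , Pk) = smaller k<n Pk
  ... | no ∄k<n            = n , Pn , λ k Pk → ℕ.≮⇒≥ (λ k<n → ∄k<n (k , k<n , Pk))

double-injective : ∀ b c → b + b ≡ c + c → b ≡ c
double-injective b c eq with ℕ.<-cmp b c
... | tri< b<c _ _ = ⊥-elim (ℕ.<⇒≢ (ℕ.+-mono-< b<c b<c) eq)
... | tri≈ _ b≡c _ = b≡c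
... | tri> _ _ c<b = ⊥-elim (ℕ.<⇒≢ (ℕ.+-mono-< c<b c<b) (≡.sym eq))

shared-summand-unique : ∀ {p p′ q q′ b c} →
                        p + b ≡ q + c → p′ + b ≡ q′ + c → p + p′ ≡ q + q′ → b ≡ c
shared-summand-unique {p} {p′} {q} {q′} {b} {c} e e′ sum-eq =
  double-injective b c (ℕ.+-cancelˡ-≡ (p + p′) (b + b) (c + c) (begin
    (p + p′) + (b + b)  ≡⟨ interchange p p′ b ⟨
    (p + b) + (p′ + b)  ≡⟨ cong₂ _+_ e e′ ⟩
    (q + c) + (q′ + c)  ≡⟨ interchange q q′ c ⟩
    (q + q′) + (c + c)  ≡⟨ cong (_+ (c + c)) sum-eq ⟨
    (p + p′) + (c + c)  ∎))
  where
  open ≡.≡-Reasoning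
  interchange : ∀ x y z → (x + z) + (y + z) ≡ (x + y) + (z + z)
  interchange = solve-∀

-- Walks and distances

module _ {N : ℕ} {E : Rel N} where

  infixr 5 _++ʷ_

  _++ʷ_ : ∀ {u v w a b} → Walk E u v a → Walk E v w b → Walk E u w (a + b)
  nil      ++ʷ q = q
  cons e p ++ʷ q = cons e (p ++ʷ q)

  reverse : Symmetric E → ∀ {u v a} → Walk E u v a → Walk E v u a
  reverse E-sym nil                = nil
  reverse E-sym (cons {m = a} e p) =
    subst (Walk E _ _) (ℕ.+-comm a 1) (reverse E-sym p ++ʷ cons (E-sym e) nil)

  walk-length-zero : ∀ {u v} → Walk E u v 0 → u ≡ v
  walk-length-zero nil = refl

  walk? : Decidable E → ∀ a u v → Dec (Walk E u v a)
  walk? E? zero u v with u Fin.≟ v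
  ... | yes refl = yes nil
  ... | no u≢v   = no (u≢v ∘ walk-length-zero)
  walk? E? (suc a) u v with Fin.any? (λ w → E? u w ×-dec walk? E? a w v)
  ... | yes (w , e , p) = yes (cons e p)
  ... | no ∄w           = no λ { (cons e p) → ∄w (_ , e , p) }

  walk⇒dist : Decidable E → ∀ {u v a} → Walk E u v a → ∃[ d ] Dist E u v d
  walk⇒dist E? {u} {v} = least-witness (λ a → walk? E? a u v)

  dist-refl : ∀ {u} → Dist E u u 0
  dist-refl = nil , λ _ _ → z≤n

  dist-unique : ∀ {u v a b} → Dist E u v a → Dist E u v b → a ≡ b
  dist-unique (p , p-min) (q , q-min) = ℕ.≤-antisym (p-min _ q) (q-min _ p)

  dist⇒resolves : ∀ {x v w a b} → Dist E v x a → Dist E w x b → a ≢ b → Resolves E x v w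
  dist⇒resolves Da Db a≢b a′ b′ Da′ Db′ a′≡b′ =
    a≢b (≡.trans (dist-unique Da Da′) (≡.trans a′≡b′ (dist-unique Db′ Db)))

  lipschitz⇒≤ : (φ : Fin N → ℕ) → (∀ {u v} → E u v → φ u ≤ suc (φ v)) →
                ∀ {u v a} → Walk E u v a → φ u ≤ a + φ v
  lipschitz⇒≤ φ φ-lip nil        = ℕ.≤-refl
  lipschitz⇒≤ φ φ-lip (cons e p) = ℕ.≤-trans (φ-lip e) (s≤s (lipschitz⇒≤ φ φ-lip p))

  potential⇒dist : (φ : Fin N → ℕ) {t : Fin N} → φ t ≡ 0 →
                   (∀ {u v} → E u v → φ u ≤ suc (φ v)) →
                   (∀ v → v ≡ t ⊎ ∃[ u ] (E v u × suc (φ u) ≡ φ v)) →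
                   ∀ v → Dist E v t (φ v)
  potential⇒dist φ {t} φt≡0 φ-lip descent v = descend (φ v) v refl , minimal
    where
    descend : ∀ n v → φ v ≡ n → Walk E v t n
    descend n v φv≡n with descent v
    ... | inj₁ refl = subst (Walk E t t) (≡.trans (≡.sym φt≡0) φv≡n) nil
    descend zero    v φv≡n | inj₂ (u , e , φu+1≡φv) =
      ⊥-elim (ℕ.1+n≢0 (≡.trans φu+1≡φv φv≡n))
    descend (suc n) v φv≡n | inj₂ (u , e , φu+1≡φv) =
      cons e (descend n u (ℕ.suc-injective (≡.trans φu+1≡φv φv≡n)))
    minimal : ∀ a → Walk E v t a → φ v ≤ a
    minimal a p =
      subst (φ v ≤_) (≡.trans (cong (a +_) φt≡0) (ℕ.+-identityʳ a)) (lipschitz⇒≤ φ φ-lip p)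

map-walk : ∀ {N N′} {E : Rel N} {E′ : Rel N′} (f : Fin N → Fin N′) →
           (∀ {u v} → E u v → E′ (f u) (f v)) → ∀ {u v a} → Walk E u v a → Walk E′ (f u) (f v) a
map-walk f f-hom nil        = nil
map-walk f f-hom (cons e p) = cons (f-hom e) (map-walk f f-hom p)

dist-involution : ∀ {N} {E : Rel N} (σ : Fin N → Fin N) → (∀ {u v} → E u v → E (σ u) (σ v)) →
                  (∀ x → σ (σ x) ≡ x) → ∀ {u v d} → Dist E (σ u) v d → Dist E u (σ v) d
dist-involution {E = E} σ σ-hom σ-involutive (p , p-min) =
  subst (λ x → Walk E x _ _) (σ-involutive _) (map-walk σ σ-hom p) ,
  λ L q → p-min L (subst (λ y → Walk E _ y L) (σ-involutive _) (map-walk σ σ-hom q))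

pendant-dist : ∀ {N} {E : Rel N} {ℓ r x d} → E ℓ r → (∀ {y} → E ℓ y → y ≡ r) → x ≢ ℓ →
               Dist E r x d → Dist E ℓ x (suc d)
pendant-dist {E = E} {ℓ} {r} {x} ℓr only-r x≢ℓ (p , p-min) = cons ℓr p , minimal
  where
  minimal : ∀ L → Walk E ℓ x L → suc _ ≤ L
  minimal zero    q          = ⊥-elim (x≢ℓ (≡.sym (walk-length-zero q)))
  minimal (suc L) (cons e q) with only-r e
  ... | refl = s≤s (p-min L q)

Connected : ∀ {N} → Rel N → Set
Connected {N} E = ∀ (u v : Fin N) → ∃[ L ] Walk E u v L

distance : ∀ {N} (G : SimpleGraph N) → Connected (Adj G) → ∀ u v → ∃[ d ] Dist (Adj G) u v d
distance G G-connected u v = walk⇒dist (adj? G) (proj₂ (G-connected u v))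

Delete-sym : ∀ {N} {E : Rel N} (X : Subset N) → Symmetric E → Symmetric (Delete X E)
Delete-sym X E-sym (u∉X , v∉X , e) = v∉X , u∉X , E-sym e

-- Counting subsets

rank : ∀ {n} (p : Subset n) {x} → x ∈ p → Fin ∣ p ∣
rank (inside ∷ p)  here        = Fin.zero
rank (inside ∷ p)  (there x∈p) = Fin.suc (rank p x∈p)
rank (outside ∷ p) (there x∈p) = rank p x∈p

rank-injective : ∀ {n} (p : Subset n) {x y} (x∈p : x ∈ p) (y∈p : y ∈ p) →
                 rank p x∈p ≡ rank p y∈p → x ≡ y
rank-injective (inside ∷ p)  here      here      _  = refl
rank-injective (inside ∷ p)  (there a) (there b) eq =
  cong Fin.suc (rank-injective p a b (Fin.suc-injective eq))
rank-injective (outside ∷ p) (there a) (there b) eq = cong Fin.suc (rank-injective p a b eq)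

injective⇒≤∣p∣ : ∀ {m n} (p : Subset n) {f : Fin m → Fin n} → Injective _≡_ _≡_ f →
                 (∀ i → f i ∈ p) → m ≤ ∣ p ∣
injective⇒≤∣p∣ p f-inj f∈p = Fin.injective⇒≤ (f-inj ∘ rank-injective p (f∈p _) (f∈p _))

∣p∪q∣≤∣p∣+∣q∣ : ∀ {n} (p q : Subset n) → ∣ p ∪ q ∣ ≤ ∣ p ∣ + ∣ q ∣
∣p∪q∣≤∣p∣+∣q∣ []            []            = z≤n
∣p∪q∣≤∣p∣+∣q∣ (inside ∷ p)  (inside ∷ q)  =
  s≤s (ℕ.≤-trans (∣p∪q∣≤∣p∣+∣q∣ p q) (ℕ.+-monoʳ-≤ ∣ p ∣ (ℕ.n≤1+n ∣ q ∣)))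
∣p∪q∣≤∣p∣+∣q∣ (inside ∷ p)  (outside ∷ q) = s≤s (∣p∪q∣≤∣p∣+∣q∣ p q)
∣p∪q∣≤∣p∣+∣q∣ (outside ∷ p) (inside ∷ q)  =
  ℕ.≤-trans (s≤s (∣p∪q∣≤∣p∣+∣q∣ p q)) (ℕ.≤-reflexive (≡.sym (ℕ.+-suc ∣ p ∣ ∣ q ∣)))
∣p∪q∣≤∣p∣+∣q∣ (outside ∷ p) (outside ∷ q) = ∣p∪q∣≤∣p∣+∣q∣ p q

image : ∀ {m n} → (Fin m → Fin n) → Subset n
image {zero}  f = ⊥
image {suc m} f = ⁅ f Fin.zero ⁆ ∪ image (f ∘ Fin.suc)

∈-image : ∀ {m n} (f : Fin m → Fin n) i → f i ∈ image f
∈-image f Fin.zero    = Subset.x∈p∪q⁺ (inj₁ (Subset.x∈⁅x⁆ (f Fin.zero)))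
∈-image f (Fin.suc i) = Subset.x∈p∪q⁺ (inj₂ (∈-image (f ∘ Fin.suc) i))

∣image∣≤ : ∀ {m n} (f : Fin m → Fin n) → ∣ image f ∣ ≤ m
∣image∣≤ {zero}  {n} f = ℕ.≤-reflexive (Subset.∣⊥∣≡0 n)
∣image∣≤ {suc m} {n} f = begin
  ∣ ⁅ f₀ ⁆ ∪ rest ∣       ≤⟨ ∣p∪q∣≤∣p∣+∣q∣ ⁅ f₀ ⁆ rest ⟩
  ∣ ⁅ f₀ ⁆ ∣ + ∣ rest ∣  ≡⟨ cong (_+ ∣ rest ∣) (Subset.∣⁅x⁆∣≡1 f₀) ⟩
  suc ∣ rest ∣           ≤⟨ s≤s (∣image∣≤ (f ∘ Fin.suc)) ⟩
  suc m                  ∎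
  where
  open ℕ.≤-Reasoning
  f₀ : Fin n
  f₀ = f Fin.zero
  rest : Subset n
  rest = image (f ∘ Fin.suc)

-- Cartesian products

module Coordinates (M N : ℕ) where

  π₁ : Fin (M * N) → Fin M
  π₁ i = proj₁ (remQuot {M} N i)

  π₂ : Fin (M * N) → Fin N
  π₂ i = proj₂ (remQuot {M} N i)

  π₁-combine : ∀ a v → π₁ (combine a v) ≡ a
  π₁-combine a v = cong proj₁ (Fin.remQuot-combine {M} {N} a v)

  π₂-combine : ∀ a v → π₂ (combine a v) ≡ v
  π₂-combine a v = cong proj₂ (Fin.remQuot-combine {M} {N} a v)

  combine-π : ∀ i → combine (π₁ i) (π₂ i) ≡ i
  combine-π = Fin.combine-remQuot {M} N

  π-injective : ∀ {i j} → π₁ i ≡ π₁ j → π₂ i ≡ π₂ j → i ≡ j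
  π-injective {i} {j} eq₁ eq₂ =
    ≡.trans (≡.sym (combine-π i)) (≡.trans (cong₂ combine eq₁ eq₂) (combine-π j))

module Product {M N : ℕ} (E : Rel M) (F : Rel N) where
  open Coordinates M N public

  □-sym : Symmetric E → Symmetric F → ∀ {i j} → (E □ F) i j → (E □ F) j i
  □-sym E-sym F-sym (inj₁ (a≡b , f)) = inj₁ (≡.sym a≡b , F-sym f)
  □-sym E-sym F-sym (inj₂ (v≡w , e)) = inj₂ (≡.sym v≡w , E-sym e)

  □-irrefl : (∀ {a} → ¬ E a a) → (∀ {v} → ¬ F v v) → ∀ {i} → ¬ (E □ F) i i
  □-irrefl E-irrefl F-irrefl (inj₁ (_ , f)) = F-irrefl f
  □-irrefl E-irrefl F-irrefl (inj₂ (_ , e)) = E-irrefl e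

  □-dec : Decidable E → Decidable F → Decidable (E □ F)
  □-dec E? F? i j =
    (π₁ i Fin.≟ π₁ j ×-dec F? (π₂ i) (π₂ j)) ⊎-dec
    (π₂ i Fin.≟ π₂ j ×-dec E? (π₁ i) (π₁ j))

  □-edgeˡ : ∀ v {a b} → E a b → (E □ F) (combine a v) (combine b v)
  □-edgeˡ v {a} {b} e =
    inj₂ (≡.trans (π₂-combine a v) (≡.sym (π₂-combine b v)) ,
          subst₂ E (≡.sym (π₁-combine a v)) (≡.sym (π₁-combine b v)) e)

  □-edgeʳ : ∀ a {v w} → F v w → (E □ F) (combine a v) (combine a w)
  □-edgeʳ a {v} {w} f =
    inj₁ (≡.trans (π₁-combine a v) (≡.sym (π₁-combine a w)) ,
          subst₂ F (≡.sym (π₂-combine a v)) (≡.sym (π₂-combine a w)) f)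

  project : ∀ {i j L} → Walk (E □ F) i j L →
            ∃[ L₁ ] ∃[ L₂ ] (L₁ + L₂ ≡ L × Walk E (π₁ i) (π₁ j) L₁ ×
                                            Walk F (π₂ i) (π₂ j) L₂)
  project nil = 0 , 0 , refl , nil , nil
  project (cons (inj₁ (a≡b , f)) p) with project p
  ... | L₁ , L₂ , L≡ , p₁ , p₂ =
    L₁ , suc L₂ , ≡.trans (ℕ.+-suc L₁ L₂) (cong suc L≡) ,
    subst (λ a → Walk E a _ L₁) (≡.sym a≡b) p₁ , cons f p₂
  project (cons (inj₂ (v≡w , e)) p) with project p
  ... | L₁ , L₂ , L≡ , p₁ , p₂ =
    suc L₁ , L₂ , cong suc L≡ ,
    cons e p₁ , subst (λ v → Walk F v _ L₂) (≡.sym v≡w) p₂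

  □-dist : ∀ {i j d₁ d₂} → Dist E (π₁ i) (π₁ j) d₁ → Dist F (π₂ i) (π₂ j) d₂ →
           Dist (E □ F) i j (d₁ + d₂)
  □-dist {i} {j} (p₁ , p₁-min) (p₂ , p₂-min) = walk , minimal
    where
    walk : Walk (E □ F) i j _
    walk = subst₂ (λ x y → Walk (E □ F) x y _) (combine-π i) (combine-π j)
             (map-walk (λ a → combine a (π₂ i)) (□-edgeˡ (π₂ i)) p₁ ++ʷ
              map-walk (combine (π₁ j)) (□-edgeʳ (π₁ j)) p₂)
    minimal : ∀ L → Walk (E □ F) i j L → _ ≤ L
    minimal L p with project p
    ... | L₁ , L₂ , L≡ , q₁ , q₂ =
      subst (_ ≤_) L≡ (ℕ.+-mono-≤ (p₁-min L₁ q₁) (p₂-min L₂ q₂))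

  □-dist-from : ∀ {a v j d₁ d₂} → Dist E a (π₁ j) d₁ → Dist F v (π₂ j) d₂ →
                Dist (E □ F) (combine a v) j (d₁ + d₂)
  □-dist-from {a} {v} D₁ D₂ =
    □-dist (subst (λ x → Dist E x _ _) (≡.sym (π₁-combine a v)) D₁)
           (subst (λ x → Dist F x _ _) (≡.sym (π₂-combine a v)) D₂)

  □-dist-to : ∀ {i b w d₁ d₂} → Dist E (π₁ i) b d₁ → Dist F (π₂ i) w d₂ →
              Dist (E □ F) i (combine b w) (d₁ + d₂)
  □-dist-to {b = b} {w} D₁ D₂ =
    □-dist (subst (λ x → Dist E _ x _) (≡.sym (π₁-combine b w)) D₁)
           (subst (λ x → Dist F _ x _) (≡.sym (π₂-combine b w)) D₂)

_□ᴳ_ : ∀ {M N} → SimpleGraph M → SimpleGraph N → SimpleGraph (M * N)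
G □ᴳ H = record
  { Adj    = Adj G □ Adj H
  ; sym    = λ {i} {j} → □-sym (sym G) (sym H) {i} {j}
  ; irrefl = λ {i} → □-irrefl (irrefl G) (irrefl H) {i}
  ; adj?   = □-dec (adj? G) (adj? H)
  }
  where open Product (Adj G) (Adj H)

-- Products with a complete graph

data Complete {k : ℕ} (a b : Fin k) : Set where
  edge : a ≢ b → Complete a b

complete : ∀ k → SimpleGraph k
complete k = record
  { Adj    = Complete
  ; sym    = λ { (edge a≢b) → edge (a≢b ∘ ≡.sym) }
  ; irrefl = λ { (edge a≢a) → a≢a refl }
  ; adj?   = λ a b → map′ edge (λ { (edge a≢b) → a≢b }) (¬? (a Fin.≟ b))
  }

complete-dist : ∀ {k} {a b : Fin k} → a ≢ b → Dist Complete a b 1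
complete-dist {a = a} {b} a≢b = cons (edge a≢b) nil , minimal
  where
  minimal : ∀ L → Walk Complete a b L → 1 ≤ L
  minimal zero    p = ⊥-elim (a≢b (walk-length-zero p))
  minimal (suc L) p = s≤s z≤n

complete-distance : ∀ {k} (a b : Fin k) → ∃[ d ] Dist Complete a b d
complete-distance a b with a Fin.≟ b
... | yes refl = 0 , dist-refl
... | no a≢b   = 1 , complete-dist a≢b

module _ {M k : ℕ} where
  open Coordinates M k using (π₁; π₂; combine-π)

  layer-meets? : (X : Subset (M * k)) → ∀ c → Dec (∃[ t ] (combine {M} t c ∈ X))
  layer-meets? X c = Fin.any? (λ t → combine t c Subset.∈? X)

  -- Otherwise choosing an element of X in every layer injects Fin k into X.
  free-layer : (X : Subset (M * k)) → ∣ X ∣ < k → ∃[ c ] (∀ t → combine t c ∉ X)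
  free-layer X ∣X∣<k with Fin.all? (layer-meets? X)
  ... | yes meets =
    ⊥-elim (ℕ.<⇒≱ ∣X∣<k (injective⇒≤∣p∣ X chosen-injective (λ c → proj₂ (meets c))))
    where
    chosen-injective : Injective _≡_ _≡_ (λ c → combine (proj₁ (meets c)) c)
    chosen-injective {c} {c′} = Fin.combine-injectiveʳ (proj₁ (meets c)) c (proj₁ (meets c′)) c′
  ... | no ¬meets with Fin.¬∀⟶∃¬ k _ (layer-meets? X) ¬meets
  ...   | c , ∄t = c , λ t t∈X → ∄t (t , t∈X)

  □-complete-kConnected : (C : SimpleGraph M) → 2 ≤ M → 1 ≤ k → Connected (Adj C) →
                          KConnected k (C □ᴳ complete k)
  □-complete-kConnected C 2≤M 1≤k C-connected =
    subst (k <_) (ℕ.*-comm k M) (ℕ.m<m*n k M ⦃ >-nonZero 1≤k ⦄ 2≤M) , connect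
    where
    open Product (Adj C) Complete using (□-edgeˡ; □-edgeʳ)
    G : SimpleGraph (M * k)
    G = C □ᴳ complete k
    connect : ∀ (X : Subset (M * k)) → ∣ X ∣ < k → ∀ u w → u ∉ X → w ∉ X →
              ∃[ L ] Walk (Delete X (Adj G)) u w L
    connect X ∣X∣<k u w u∉X w∉X with free-layer X ∣X∣<k
    ... | c , c-free =
      _ , (proj₂ (to-layer u u∉X) ++ʷ along-layer ++ʷ
           reverse (Delete-sym X (sym G)) (proj₂ (to-layer w w∉X)))
      where
      to-layer : ∀ z → z ∉ X → ∃[ L ] Walk (Delete X (Adj G)) z (combine (π₁ z) c) L
      to-layer z z∉X with π₂ z Fin.≟ c
      ... | yes z≡c =
        0 , subst (λ y → Walk _ z y 0) (≡.trans (≡.sym (combine-π z)) (cong (combine (π₁ z)) z≡c)) nil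
      ... | no  z≢c = 1 , cons (z∉X , c-free (π₁ z) , step) nil
        where
        step : Adj G z (combine (π₁ z) c)
        step = subst (λ y → Adj G y (combine (π₁ z) c)) (combine-π z) (□-edgeʳ (π₁ z) (edge z≢c))
      along-layer : Walk (Delete X (Adj G)) (combine (π₁ u) c) (combine (π₁ w) c) _
      along-layer = map-walk (λ t → combine t c) (λ {t} {t′} e → c-free t , c-free t′ , □-edgeˡ c e)
                       (proj₂ (C-connected (π₁ u) (π₁ w)))

module _ {M k : ℕ} (C : SimpleGraph M) (C-connected : Connected (Adj C)) where
  open Product (Adj C) (Complete {k}) using (π₁; π₂; π-injective; □-dist-to)

  -- Vertices in different layers are told apart by the copy of one landmark in the layer of
  -- whichever of them is nearer to it in C; vertices in the same layer by the copy there of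
  -- a landmark resolving them in C.
  □-complete-metricDim≤ : ∀ {B} (landmark : Fin (suc B) → Fin M) →
                          (∀ v w → v ≢ w → ∃[ b ] Resolves (Adj C) (landmark b) v w) →
                          MetricDim≤ (Adj C □ Complete) (suc B * k)
  □-complete-metricDim≤ {B} landmark resolved = image copy , copies-resolving , ∣image∣≤ copy
    where
    module L = Coordinates (suc B) k

    copy : Fin (suc B * k) → Fin (M * k)
    copy i = combine (landmark (L.π₁ i)) (L.π₂ i)

    copy∈image : ∀ b c → combine (landmark b) c ∈ image copy
    copy∈image b c =
      subst (_∈ image copy) (cong₂ (combine ∘ landmark) (L.π₁-combine b c) (L.π₂-combine b c))
        (∈-image copy (combine b c))

    dist-C : ∀ u v → ∃[ d ] Dist (Adj C) u v d
    dist-C = distance C C-connected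

    dist-in-layer : ∀ i {x d} → Dist (Adj C) (π₁ i) x d → Dist (Adj C □ Complete) i (combine x (π₂ i)) d
    dist-in-layer i {d = d} D = subst (Dist _ i _) (ℕ.+-identityʳ d) (□-dist-to D dist-refl)

    copies-resolving : Resolving (Adj C □ Complete) (image copy)
    copies-resolving v w v≢w with π₂ v Fin.≟ π₂ w
    ... | yes same-layer with resolved (π₁ v) (π₁ w) (v≢w ∘ flip π-injective same-layer)
    ...   | b , resolves with dist-C (π₁ v) (landmark b) | dist-C (π₁ w) (landmark b)
    ...     | a , Da | a′ , Da′ =
      _ , copy∈image b (π₂ v) ,
      dist⇒resolves (dist-in-layer v Da)
                    (subst (λ c → Dist _ w (combine (landmark b) c) a′) (≡.sym same-layer)
                           (dist-in-layer w Da′))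
                    (resolves a a′ Da Da′)
    copies-resolving v w v≢w | no other-layer
      with dist-C (π₁ v) (landmark Fin.zero) | dist-C (π₁ w) (landmark Fin.zero)
    ... | a , Da | b , Db with ℕ.≤-<-connex a b
    ...   | inj₁ a≤b = _ , copy∈image Fin.zero (π₂ v) ,
      dist⇒resolves (□-dist-to Da dist-refl) (□-dist-to Db (complete-dist (other-layer ∘ ≡.sym)))
                    (ℕ.<⇒≢ (ℕ.+-mono-≤-< a≤b z<s))
    ...   | inj₂ b<a = _ , copy∈image Fin.zero (π₂ w) ,
      dist⇒resolves (□-dist-to Da (complete-dist other-layer)) (□-dist-to Db dist-refl)
                    (ℕ.<⇒≢ (ℕ.+-mono-<-≤ b<a z≤n) ∘ ≡.sym)

-- Pendant families

record PendantFamily {N : ℕ} (E : Rel N) (m : ℕ) : Set₁ where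
  field
    tip root    : Fin m → Fin N
    tip≢root    : ∀ i → tip i ≢ root i
    Near        : Fin m → Fin N → Set
    near?       : ∀ i x → Dec (Near i x)
    near-unique : ∀ {i j x} → Near i x → Near j x → i ≡ j
    pendant     : ∀ i x → ¬ Near i x → ∃[ d ] (Dist E (root i) x d × Dist E (tip i) x (suc d))

module _ {N m : ℕ} {E : Rel N} (P : PendantFamily E m) where
  open PendantFamily P
  open Product E E

  resolver-near-tip : ∀ (T : Subset (N * N)) → Resolving (E □ E) T →
                      ∀ i j → ∃[ s ] (s ∈ T × (Near i (π₁ s) ⊎ Near j (π₂ s)))
  resolver-near-tip T T-resolving i j
    with T-resolving (combine (tip i) (root j)) (combine (root i) (tip j)) pair-distinct
    where
    pair-distinct : combine (tip i) (root j) ≢ combine (root i) (tip j)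
    pair-distinct = tip≢root i ∘ Fin.combine-injectiveˡ (tip i) (root j) (root i) (tip j)
  ... | s , s∈T , s-resolves with near? i (π₁ s) | near? j (π₂ s)
  ...   | yes near₁ | _         = s , s∈T , inj₁ near₁
  ...   | no _      | yes near₂ = s , s∈T , inj₂ near₂
  ...   | no far₁   | no far₂ with pendant i (π₁ s) far₁ | pendant j (π₂ s) far₂
  ...     | d₁ , root₁ , tip₁ | d₂ , root₂ , tip₂ =
    ⊥-elim (s-resolves _ _ (□-dist-from tip₁ root₂) (□-dist-from root₁ tip₂)
                           (≡.sym (ℕ.+-suc d₁ d₂)))

  near-landmark? : (T : Subset (N * N)) (π : Fin (N * N) → Fin N) →
                   ∀ i → Dec (∃[ s ] (s ∈ T × Near i (π s)))
  near-landmark? T π i = Fin.any? (λ s → s Subset.∈? T ×-dec near? i (π s))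

  all-near⇒≤∣T∣ : ∀ (T : Subset (N * N)) (π : Fin (N * N) → Fin N) →
                  (∀ i → ∃[ s ] (s ∈ T × Near i (π s))) → m ≤ ∣ T ∣
  all-near⇒≤∣T∣ T π near = injective⇒≤∣p∣ T landmark-injective (proj₁ ∘ proj₂ ∘ near)
    where
    landmark-injective : Injective _≡_ _≡_ (proj₁ ∘ near)
    landmark-injective {i} {j} eq =
      near-unique (proj₂ (proj₂ (near i))) (subst (Near j ∘ π) (≡.sym eq) (proj₂ (proj₂ (near j))))

  pendantFamily⇒metricDim≥ : MetricDim≥ (E □ E) m
  pendantFamily⇒metricDim≥ T T-resolving with Fin.all? (near-landmark? T π₁)
  ... | yes near₁ = all-near⇒≤∣T∣ T π₁ near₁
  ... | no ¬near₁ with Fin.¬∀⟶∃¬ m _ (near-landmark? T π₁) ¬near₁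
  ...   | i , ∄s = all-near⇒≤∣T∣ T π₂ near₂
    where
    near₂ : ∀ j → ∃[ s ] (s ∈ T × Near j (π₂ s))
    near₂ j with resolver-near-tip T T-resolving i j
    ... | s , s∈T , inj₁ near = ⊥-elim (∄s (s , s∈T , near))
    ... | s , s∈T , inj₂ near = s , s∈T , near

pendants⇒PendantFamily : ∀ {N m} (G : SimpleGraph N) → Connected (Adj G) →
                         (tip root : Fin m → Fin N) → Injective _≡_ _≡_ tip →
                         (∀ i → Adj G (tip i) (root i)) →
                         (∀ i {y} → Adj G (tip i) y → y ≡ root i) →
                         PendantFamily (Adj G) m
pendants⇒PendantFamily G G-connected tip root tip-injective tip-root only-root = record
  { tip         = tip
  ; root        = root
  ; tip≢root    = λ i eq → irrefl G (subst (Adj G (tip i)) (≡.sym eq) (tip-root i))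
  ; Near        = λ i x → x ≡ tip i
  ; near?       = λ i x → x Fin.≟ tip i
  ; near-unique = λ x≡tipᵢ x≡tipⱼ → tip-injective (≡.trans (≡.sym x≡tipᵢ) x≡tipⱼ)
  ; pendant     = λ i x x≢tip → let (d , D) = distance G G-connected (root i) x in
                                 d , D , pendant-dist (tip-root i) (only-root i) x≢tip D
  }

□-PendantFamily : ∀ {M N m} {E : Rel M} {F : Rel N} → PendantFamily E m →
                  (c : Fin N) → (∀ v → ∃[ e ] Dist F c v e) → PendantFamily (E □ F) m
□-PendantFamily {E = E} {F} P c from-c = record
  { tip         = λ i → combine (tip i) c
  ; root        = λ i → combine (root i) c
  ; tip≢root    = λ i → tip≢root i ∘ Fin.combine-injectiveˡ (tip i) c (root i) c
  ; Near        = λ i x → Near i (π₁ x)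
  ; near?       = λ i x → near? i (π₁ x)
  ; near-unique = near-unique
  ; pendant     = λ i x far → let (d , D-root , D-tip) = pendant i (π₁ x) far
                                  (e , D-layer) = from-c (π₂ x) in
                              d + e , □-dist-from D-root D-layer , □-dist-from D-tip D-layer
  }
  where
  open PendantFamily P
  open Product E F

-- The comb

module Comb (m₀ : ℕ) where
  m : ℕ
  m = suc m₀

  Vertex : Set
  Vertex = Fin m × Fin 2

  Consecutive : Fin m → Fin m → Set
  Consecutive p q = suc (toℕ p) ≡ toℕ q ⊎ suc (toℕ q) ≡ toℕ p

  -- (p , 0) is the p-th vertex of the spine and (p , 1) the tooth attached to it.
  data _~_ : Vertex → Vertex → Set where
    spine : ∀ {p q} → Consecutive p q → (p , Fin.zero) ~ (q , Fin.zero)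
    tooth : ∀ {p b c} → b ≢ c → (p , b) ~ (p , c)

  ~-sym : Symmetric _~_
  ~-sym (spine (inj₁ e)) = spine (inj₂ e)
  ~-sym (spine (inj₂ e)) = spine (inj₁ e)
  ~-sym (tooth b≢c)      = tooth (b≢c ∘ ≡.sym)

  ~-irrefl : ∀ {x} → ¬ x ~ x
  ~-irrefl (spine (inj₁ e)) = ℕ.1+n≢n e
  ~-irrefl (spine (inj₂ e)) = ℕ.1+n≢n e
  ~-irrefl (tooth b≢b)      = b≢b refl

  _~?_ : Decidable _~_
  (p , Fin.zero)         ~? (q , Fin.zero)         =
    map′ spine (λ { (spine c) → c ; (tooth 0≢0) → ⊥-elim (0≢0 refl) })
      ((suc (toℕ p) ℕ.≟ toℕ q) ⊎-dec (suc (toℕ q) ℕ.≟ toℕ p))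
  (p , Fin.zero)         ~? (q , Fin.suc Fin.zero) with p Fin.≟ q
  ... | yes refl = yes (tooth λ ())
  ... | no p≢q   = no λ { (tooth _) → p≢q refl }
  (p , Fin.suc Fin.zero) ~? (q , Fin.zero)         with p Fin.≟ q
  ... | yes refl = yes (tooth λ ())
  ... | no p≢q   = no λ { (tooth _) → p≢q refl }
  (p , Fin.suc Fin.zero) ~? (q , Fin.suc Fin.zero) = no λ { (tooth 1≢1) → 1≢1 refl }

  height : Vertex → ℕ
  height (p , b) = toℕ p + toℕ b

  end : Vertex
  end = Fin.zero , Fin.zero

  height-lipschitz : ∀ {x y} → x ~ y → height x ≤ suc (height y)
  height-lipschitz (spine {p} {q} (inj₁ e)) rewrite ℕ.+-identityʳ (toℕ p) | ℕ.+-identityʳ (toℕ q) =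
    ℕ.≤-trans (ℕ.n≤1+n (toℕ p)) (ℕ.≤-trans (ℕ.≤-reflexive e) (ℕ.n≤1+n (toℕ q)))
  height-lipschitz (spine {p} {q} (inj₂ e)) rewrite ℕ.+-identityʳ (toℕ p) | ℕ.+-identityʳ (toℕ q) =
    ℕ.≤-reflexive (≡.sym e)
  height-lipschitz (tooth {p} {b} {c} _) = begin
    toℕ p + toℕ b        ≤⟨ ℕ.+-monoʳ-≤ (toℕ p) b≤1+c ⟩
    toℕ p + suc (toℕ c)  ≡⟨ ℕ.+-suc (toℕ p) (toℕ c) ⟩
    suc (toℕ p + toℕ c)  ∎
    where
    open ℕ.≤-Reasoning
    b≤1+c : toℕ b ≤ suc (toℕ c)
    b≤1+c = ℕ.≤-trans (ℕ.≤-pred (Fin.toℕ<n b)) (s≤s z≤n)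

  descent : ∀ x → x ≡ end ⊎ ∃[ y ] (x ~ y × suc (height y) ≡ height x)
  descent (Fin.zero  , Fin.zero)         = inj₁ refl
  descent (Fin.suc p , Fin.zero)         =
    inj₂ ((inject₁ p , Fin.zero) , spine (inj₂ (cong suc (Fin.toℕ-inject₁ p))) ,
          cong (λ n → suc (n + 0)) (Fin.toℕ-inject₁ p))
  descent (p         , Fin.suc Fin.zero) =
    inj₂ ((p , Fin.zero) , tooth (λ ()) , ≡.sym (ℕ.+-suc (toℕ p) 0))

  reflect : Vertex → Vertex
  reflect (p , b) = opposite p , b

  reflect-involutive : ∀ x → reflect (reflect x) ≡ x
  reflect-involutive (p , b) = cong (_, b) (Fin.opposite-involutive p)

  opposite-sum : ∀ (p : Fin m) → toℕ p + toℕ (opposite p) ≡ m₀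
  opposite-sum p =
    ≡.trans (cong (toℕ p +_) (Fin.opposite-prop p)) (ℕ.m+[n∸m]≡n (ℕ.≤-pred (Fin.toℕ<n p)))

  opposite-consecutive : ∀ {p q : Fin m} → suc (toℕ p) ≡ toℕ q →
                         suc (toℕ (opposite q)) ≡ toℕ (opposite p)
  opposite-consecutive {p} {q} e = ℕ.+-cancelˡ-≡ (toℕ p) _ _ (begin
    toℕ p + suc (toℕ (opposite q))  ≡⟨ ℕ.+-suc (toℕ p) (toℕ (opposite q)) ⟩
    suc (toℕ p) + toℕ (opposite q)  ≡⟨ cong (_+ toℕ (opposite q)) e ⟩
    toℕ q + toℕ (opposite q)        ≡⟨ opposite-sum q ⟩
    m₀                              ≡⟨ opposite-sum p ⟨
    toℕ p + toℕ (opposite p)        ∎)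
    where open ≡.≡-Reasoning

  reflect-~ : ∀ {x y} → x ~ y → reflect x ~ reflect y
  reflect-~ (spine (inj₁ e)) = spine (inj₂ (opposite-consecutive e))
  reflect-~ (spine (inj₂ e)) = spine (inj₁ (opposite-consecutive e))
  reflect-~ (tooth b≢c)      = tooth b≢c

  -- height (p , b) + height (reflect (p , b)) = m₀ + 2b determines b, and then height determines p.
  heights-injective : ∀ {x y} → height x ≡ height y →
                      height (reflect x) ≡ height (reflect y) → x ≡ y
  heights-injective {p , b} {q , c} e e′ = cong₂ _,_ (Fin.toℕ-injective p≡q) (Fin.toℕ-injective b≡c)
    where
    b≡c : toℕ b ≡ toℕ c
    b≡c = shared-summand-unique e e′ (≡.trans (opposite-sum p) (≡.sym (opposite-sum q)))
    p≡q : toℕ p ≡ toℕ q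
    p≡q = ℕ.+-cancelʳ-≡ (toℕ b) (toℕ p) (toℕ q) (≡.trans e (cong (toℕ q +_) (≡.sym b≡c)))

  ⌊_⌋ : Fin (m * 2) → Vertex
  ⌊ i ⌋ = remQuot {m} 2 i

  ⌈_⌉ : Vertex → Fin (m * 2)
  ⌈_⌉ = uncurry combine

  ⌊⌈_⌉⌋ : ∀ x → ⌊ ⌈ x ⌉ ⌋ ≡ x
  ⌊⌈ p , b ⌉⌋ = Fin.remQuot-combine p b

  ⌈⌊_⌋⌉ : ∀ i → ⌈ ⌊ i ⌋ ⌉ ≡ i
  ⌈⌊_⌋⌉ = Fin.combine-remQuot {m} 2

  data Comb (i j : Fin (m * 2)) : Set where
    comb : ⌊ i ⌋ ~ ⌊ j ⌋ → Comb i j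

  comb-graph : SimpleGraph (m * 2)
  comb-graph = record
    { Adj    = Comb
    ; sym    = λ { (comb e) → comb (~-sym e) }
    ; irrefl = λ { (comb e) → ~-irrefl e }
    ; adj?   = λ i j → map′ comb (λ { (comb e) → e }) (⌊ i ⌋ ~? ⌊ j ⌋)
    }

  comb-edge : ∀ {x y} → x ~ y → Comb ⌈ x ⌉ ⌈ y ⌉
  comb-edge {x} {y} e = comb (subst₂ _~_ (≡.sym ⌊⌈ x ⌉⌋) (≡.sym ⌊⌈ y ⌉⌋) e)

  dist-to-end : ∀ i → Dist Comb i ⌈ end ⌉ (height ⌊ i ⌋)
  dist-to-end =
    potential⇒dist (height ∘ ⌊_⌋) (cong height ⌊⌈ end ⌉⌋)
                   (λ { (comb e) → height-lipschitz e }) step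
    where
    step : ∀ i → i ≡ ⌈ end ⌉ ⊎ ∃[ j ] (Comb i j × suc (height ⌊ j ⌋) ≡ height ⌊ i ⌋)
    step i with descent ⌊ i ⌋
    ... | inj₁ at-end          = inj₁ (≡.trans (≡.sym ⌈⌊ i ⌋⌉) (cong ⌈_⌉ at-end))
    ... | inj₂ (y , e , lower) =
      inj₂ (⌈ y ⌉ , comb (subst (⌊ i ⌋ ~_) (≡.sym ⌊⌈ y ⌉⌋) e) ,
            ≡.trans (cong (suc ∘ height) ⌊⌈ y ⌉⌋) lower)

  comb-connected : Connected Comb
  comb-connected i j = _ , (proj₁ (dist-to-end i) ++ʷ reverse (sym comb-graph) (proj₁ (dist-to-end j)))

  mirror : Fin (m * 2) → Fin (m * 2)
  mirror i = ⌈ reflect ⌊ i ⌋ ⌉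

  mirror-hom : ∀ {i j} → Comb i j → Comb (mirror i) (mirror j)
  mirror-hom (comb e) = comb-edge (reflect-~ e)

  mirror-involutive : ∀ i → mirror (mirror i) ≡ i
  mirror-involutive i = ≡.trans (cong (⌈_⌉ ∘ reflect) ⌊⌈ reflect ⌊ i ⌋ ⌉⌋)
                                (≡.trans (cong ⌈_⌉ (reflect-involutive ⌊ i ⌋)) ⌈⌊ i ⌋⌉)

  dist-to-far-end : ∀ i → Dist Comb i (mirror ⌈ end ⌉) (height (reflect ⌊ i ⌋))
  dist-to-far-end i = dist-involution mirror mirror-hom mirror-involutive
    (subst (Dist Comb (mirror i) ⌈ end ⌉) (cong height ⌊⌈ reflect ⌊ i ⌋ ⌉⌋)
           (dist-to-end (mirror i)))

  ends : Fin 2 → Fin (m * 2)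
  ends Fin.zero           = ⌈ end ⌉
  ends (Fin.suc Fin.zero) = mirror ⌈ end ⌉

  ends-resolve : ∀ v w → v ≢ w → ∃[ b ] Resolves Comb (ends b) v w
  ends-resolve v w v≢w with height ⌊ v ⌋ ℕ.≟ height ⌊ w ⌋
  ... | no  heights≢ = Fin.zero , dist⇒resolves (dist-to-end v) (dist-to-end w) heights≢
  ... | yes heights≡ =
    Fin.suc Fin.zero , dist⇒resolves (dist-to-far-end v) (dist-to-far-end w) far-heights≢
    where
    far-heights≢ : height (reflect ⌊ v ⌋) ≢ height (reflect ⌊ w ⌋)
    far-heights≢ eq = v≢w (begin
      v          ≡⟨ ⌈⌊ v ⌋⌉ ⟨
      ⌈ ⌊ v ⌋ ⌉  ≡⟨ cong ⌈_⌉ (heights-injective {⌊ v ⌋} {⌊ w ⌋} heights≡ eq) ⟩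
      ⌈ ⌊ w ⌋ ⌉  ≡⟨ ⌈⌊ w ⌋⌉ ⟩
      w          ∎)
      where open ≡.≡-Reasoning

  tip-neighbour : ∀ {p y} → (p , Fin.suc Fin.zero) ~ y → y ≡ (p , Fin.zero)
  tip-neighbour (tooth {c = Fin.zero}         _)   = refl
  tip-neighbour (tooth {c = Fin.suc Fin.zero} 1≢1) = ⊥-elim (1≢1 refl)

  comb-PendantFamily : PendantFamily Comb m
  comb-PendantFamily = pendants⇒PendantFamily comb-graph comb-connected tip root
    (λ {p} {q} → Fin.combine-injectiveˡ p (Fin.suc Fin.zero) q (Fin.suc Fin.zero))
    (λ p → comb-edge {p , Fin.suc Fin.zero} {p , Fin.zero} (tooth λ ()))
    only-root
    where
    tip root : Fin m → Fin (m * 2)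
    tip  p = ⌈ p , Fin.suc Fin.zero ⌉
    root p = ⌈ p , Fin.zero ⌉
    only-root : ∀ p {y} → Comb (tip p) y → y ≡ root p
    only-root p {y} (comb e) =
      ≡.trans (≡.sym ⌈⌊ y ⌋⌉)
              (cong ⌈_⌉ (tip-neighbour (subst (_~ ⌊ y ⌋) ⌊⌈ p , Fin.suc Fin.zero ⌉⌋ e)))

theorem9p4 : ∀ (k n : ℕ) → 1 ≤ k → 2 ≤ n →
    Σ ℕ (λ N → Σ (SimpleGraph N) (λ G →
      KConnected k G × MetricDim≤ (Adj G) (2 * k) × MetricDim≥ (Adj G □ Adj G) n))
theorem9p4 zero      _        ()  _
theorem9p4 (suc k₀)  zero     _   ()
theorem9p4 k@(suc _) (suc n₀) 1≤k _ =
  _ , comb-graph □ᴳ complete k ,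
  □-complete-kConnected comb-graph (s≤s (s≤s z≤n)) 1≤k comb-connected ,
  □-complete-metricDim≤ comb-graph comb-connected ends ends-resolve ,
  pendantFamily⇒metricDim≥ (□-PendantFamily comb-PendantFamily Fin.zero (complete-distance Fin.zero))
  where open Comb n₀
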